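{- The logic $\mathrm{FO}^{2+}[\mathfrak{B}_<]$ is equivalent to $\mathrm{UTL}^+[\mathrm{P},\mathrm{F},\mathrm{H},\mathrm{G}]$: for every $\mathrm{FO}^{2+}[\mathfrak{B}_<]$ formula $\varphi(x)$ with one free variable there is a $\mathrm{UTL}^+[\mathrm{P},\mathrm{F},\mathrm{H},\mathrm{G}]$ formula $\psi$ with $(u,[x\mapsto i])\models\varphi$ iff $u,i\models\psi$ for all words $u$ and positions $i$, and conversely.
   Context: Let $\Sigma$ be a finite set of unary predicates, alphabet $A=2^\Sigma$, words $u=u_0\cdots u_{m-1}$. $\mathfrak{B}_<=\{\le,<\}$ (with $=$ and $\ne$ also available). $\mathrm{FO}^{2+}[\mathfrak{B}_<]$ is the set of first-order formulas built from $\bot,\top$, atoms $x<y$, $x\le y$, $x=y$, $x\ne y$ on positions, atoms $a(x)$ with $a\in\Sigma$ (true iff $a$ belongs to the letter at position $x$), $\wedge,\vee,\exists,\forall$, without negation, using only two distinct variable names (reusable). $\mathrm{UTL}^+[\mathrm{P},\mathrm{F},\mathrm{H},\mathrm{G}]$ has grammar $\varphi,\psi::=\bot\mid\top\mid a\mid\varphi\wedge\psi\mid\varphi\vee\psi\mid\mathrm{P}\varphi\mid\mathrm{F}\varphi\mid\mathrm{H}\varphi\mid\mathrm{G}\varphi$, evaluated at a position $i$: $u,i\models a$ iff $a\in u_i$; $\mathrm{F}\varphi$ (resp. $\mathrm{P}\varphi$) holds iff $\varphi$ holds at some position $j>i$ (resp. $j<i$); $\mathrm{G}\varphi$ (resp.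 $\mathrm{H}\varphi$) holds iff $\varphi$ holds at all positions $j>i$ (resp. $j<i$). -}

module Defs where

open import Data.Nat using (ℕ)
open import Data.Fin using (Fin; _<_; _≤_)
open import Data.Bool using (Bool; T)
open import Data.List using (List; length; lookup)
open import Data.Product using (_×_; Σ-syntax)
open import Data.Sum using (_⊎_)
open import Data.Empty using (⊥)
open import Data.Unit using (⊤)
open import Relation.Binary.PropositionalEquality using (_≡_; _≢_)

-- Σ = Fin k (k unary predicates); a letter is a subset of Σ (alphabet A = 2^Σ)
Letter : ℕ → Set
Letter k = Fin k → Bool

Word : ℕ → Set
Word k = List (Letter k)

Pos : ∀ {k} → Word k → Set
Pos u = Fin (length u)

holds : ∀ {k} (u : Word k) → Pos u → Fin k → Set
holds u i a = T (lookup u i a)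

data Var : Set where
  vx vy : Var

data FO2 (k : ℕ) : Set where
  ff tt : FO2 k
  _<′_ _≤′_ _=′_ _≠′_ : Var → Var → FO2 k
  atom : Fin k → Var → FO2 k
  _∧′_ _∨′_ : FO2 k → FO2 k → FO2 k
  ∃′ ∀′ : Var → FO2 k → FO2 k

FreeIn : ∀ {k} → Var → FO2 k → Set
FreeIn v ff = ⊥
FreeIn v tt = ⊥
FreeIn v (a <′ b) = (v ≡ a) ⊎ (v ≡ b)
FreeIn v (a ≤′ b) = (v ≡ a) ⊎ (v ≡ b)
FreeIn v (a =′ b) = (v ≡ a) ⊎ (v ≡ b)
FreeIn v (a ≠′ b) = (v ≡ a) ⊎ (v ≡ b)
FreeIn v (atom a b) = v ≡ b
FreeIn v (φ ∧′ ψ) = FreeIn v φ ⊎ FreeIn v ψ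
FreeIn v (φ ∨′ ψ) = FreeIn v φ ⊎ FreeIn v ψ
FreeIn v (∃′ w φ) = (v ≢ w) × FreeIn v φ
FreeIn v (∀′ w φ) = (v ≢ w) × FreeIn v φ

OneFreeX : ∀ {k} → FO2 k → Set
OneFreeX φ = FreeIn vy φ → ⊥

Env : ∀ {k} → Word k → Set
Env u = Var → Pos u

update : ∀ {k} {u : Word k} → Env u → Var → Pos u → Env u
update σ vx i vx = i
update σ vx i vy = σ vy
update σ vy i vx = σ vx
update σ vy i vy = i

_,_⊨FO_ : ∀ {k} (u : Word k) → Env u → FO2 k → Set
u , σ ⊨FO ff = ⊥
u , σ ⊨FO tt = ⊤
u , σ ⊨FO (a <′ b) = σ a < σ b
u , σ ⊨FO (a ≤′ b) = σ a ≤ σ b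
u , σ ⊨FO (a =′ b) = σ a ≡ σ b
u , σ ⊨FO (a ≠′ b) = σ a ≢ σ b
u , σ ⊨FO atom a v = holds u (σ v) a
u , σ ⊨FO (φ ∧′ ψ) = (u , σ ⊨FO φ) × (u , σ ⊨FO ψ)
u , σ ⊨FO (φ ∨′ ψ) = (u , σ ⊨FO φ) ⊎ (u , σ ⊨FO ψ)
u , σ ⊨FO ∃′ v φ = Σ[ j ∈ Pos u ] (u , update {u = u} σ v j ⊨FO φ)
u , σ ⊨FO ∀′ v φ = (j : Pos u) → u , update {u = u} σ v j ⊨FO φ

-- the assignment [x ↦ i] (y is also sent to i; irrelevant when y is not free)
[x↦_] : ∀ {k} {u : Word k} → Pos u → Env u
[x↦ i ] _ = i

data UTL (k : ℕ) : Set where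
  ff tt : UTL k
  atom : Fin k → UTL k
  _∧′_ _∨′_ : UTL k → UTL k → UTL k
  P F H G : UTL k → UTL k

_,_⊨UTL_ : ∀ {k} (u : Word k) → Pos u → UTL k → Set
u , i ⊨UTL ff = ⊥
u , i ⊨UTL tt = ⊤
u , i ⊨UTL atom a = holds u i a
u , i ⊨UTL (φ ∧′ ψ) = (u , i ⊨UTL φ) × (u , i ⊨UTL ψ)
u , i ⊨UTL (φ ∨′ ψ) = (u , i ⊨UTL φ) ⊎ (u , i ⊨UTL ψ)
u , i ⊨UTL P φ = Σ[ j ∈ Pos u ] (j < i × (u , j ⊨UTL φ))
u , i ⊨UTL F φ = Σ[ j ∈ Pos u ] (i < j × (u , j ⊨UTL φ))
u , i ⊨UTL H φ = (j : Pos u) → j < i → u , j ⊨UTL φ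
u , i ⊨UTL G φ = (j : Pos u) → i < j → u , j ⊨UTL φ

{-# OPTIONS --safe #-}
-- On each of the three order types x < y, x = y, x > y, an FO²⁺ formula φ(x, y) is
-- equivalent to a positive Boolean combination of UTL⁺ formulas evaluated at x and at y:
-- order atoms become constants, and ∃y is eliminated by bringing the combination into
-- disjunctive normal form ⋁ a(x) ∧ b(y) and replacing each clause by a ∧ F b, a ∧ b or
-- a ∧ P b according to the order type. Dually, ∀y uses the conjunctive normal form
-- ⋀ a(x) ∨ b(y) and G, identity, H; since positions range over a finite set, a(x) can be
-- pulled out of ∀y (a(x) ∨ b(y)) constructively. Identifying y with x then yields a UTL⁺
-- formula. Conversely, the standard translation alternates the roles of x and y at each
-- modality; without negation, H ψ becomes ∀y (x ≤ y ∨ ψ(y)).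
module Submission where

open import Defs
open import Data.Nat using (ℕ)
open import Data.Product using (_×_; Σ-syntax)
open import Function.Bundles using (_⇔_)

open import Level using (0ℓ)
open import Algebra.Bundles using (CommutativeMonoid)
import Algebra.Properties.CommutativeSemigroup as CommutativeSemigroupProperties
open import Data.Bool using (Bool; true; false; T; if_then_else_)
open import Data.Empty using (⊥-elim)
open import Data.Fin using (Fin; zero; suc; _<_; _≤_)
open import Data.Fin.Properties using (<-cmp; _<?_; _≤?_; _≟_; ≤-reflexive)
open import Data.Nat.Properties using (<⇒≤; <⇒≱; ≰⇒>)
open import Data.Product using (Σ; _,_; proj₁; proj₂)
open import Data.Product.Function.Dependent.Propositional using (congˡ)
open import Data.Product.Function.NonDependent.Propositional using (_×-⇔_)
open import Data.Sum using (_⊎_; inj₁; inj₂; [_,_]; map₂)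
open import Data.Sum.Function.Propositional using (_⊎-⇔_)
open import Data.Unit using (tt)
open import Function.Base using (_∘_; const)
open import Function.Bundles using (mk⇔; module Equivalence)
open import Function.Construct.Composition using (_⇔-∘_)
open import Function.Construct.Identity using (⇔-id)
open import Function.Construct.Symmetry using (⇔-sym)
open import Function.Properties.Inverse using (↔⇒⇔)
open import Function.Related.Propositional using (equivalence; module EquationalReasoning)
open import Function.Related.TypeIsomorphisms
  using ( Σ-distribˡ-⊎; ×-distribˡ-⊎; ×-distribʳ-⊎; →-cong-⇔
        ; ×-commutativeMonoid; ⊎-commutativeMonoid )
open import Relation.Binary.Definitions using (tri<; tri≈; tri>)
open import Relation.Binary.PropositionalEquality using (_≡_; _≢_; refl; sym; subst; cong)
open import Relation.Nullary using (Dec; yes; no)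
open import Relation.Unary using (Decidable)

open Equivalence using (to; from)
open EquationalReasoning {k = equivalence}

private
  variable
    k n : ℕ
    I A B C : Set

open CommutativeSemigroupProperties
  (CommutativeMonoid.commutativeSemigroup (×-commutativeMonoid equivalence 0ℓ))
  using () renaming (interchange to ×-interchange)
open CommutativeSemigroupProperties
  (CommutativeMonoid.commutativeSemigroup (⊎-commutativeMonoid equivalence 0ℓ))
  using () renaming (interchange to ⊎-interchange)

⊎-distribˡ-× : (A ⊎ (B × C)) ⇔ ((A ⊎ B) × (A ⊎ C))
⊎-distribˡ-× = mk⇔ [ (λ a → inj₁ a , inj₁ a) , (λ (b , c) → inj₂ b , inj₂ c) ] λ where
  (inj₁ a , _) → inj₁ a
  (inj₂ _ , inj₁ a) → inj₁ a
  (inj₂ b , inj₂ c) → inj₂ (b , c)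

⊎-distribʳ-× : ((A × B) ⊎ C) ⇔ ((A ⊎ C) × (B ⊎ C))
⊎-distribʳ-× = mk⇔ [ (λ (a , b) → inj₁ a , inj₁ b) , (λ c → inj₂ c , inj₂ c) ] λ where
  (inj₂ c , _) → inj₂ c
  (inj₁ _ , inj₂ c) → inj₂ c
  (inj₁ a , inj₁ b) → inj₁ (a , b)

Σ-cong : {U V : I → Set} → (∀ x → U x ⇔ V x) → Σ I U ⇔ Σ I V
Σ-cong U⇔V = congˡ {k = equivalence} (λ {x} → U⇔V x)

Π-cong : {U V : I → Set} → (∀ x → U x ⇔ V x) → (∀ x → U x) ⇔ (∀ x → V x)
Π-cong U⇔V = mk⇔ (λ f x → to (U⇔V x) (f x)) (λ g x → from (U⇔V x) (g x))

guarded-∃-distrib-⊎ : {R U V : I → Set} →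
  (Σ[ x ∈ I ] (R x × (U x ⊎ V x))) ⇔ (Σ[ x ∈ I ] (R x × U x) ⊎ Σ[ x ∈ I ] (R x × V x))
guarded-∃-distrib-⊎ = ↔⇒⇔ Σ-distribˡ-⊎ ⇔-∘ Σ-cong (λ _ → ↔⇒⇔ ×-distribˡ-⊎)

guarded-∀-distrib-× : {R U V : I → Set} →
  (∀ x → R x → U x × V x) ⇔ ((∀ x → R x → U x) × (∀ x → R x → V x))
guarded-∀-distrib-× = mk⇔
  (λ h → (λ x ρ → proj₁ (h x ρ)) , (λ x ρ → proj₂ (h x ρ)))
  (λ (h , h′) x ρ → h x ρ , h′ x ρ)

∀⊎⇒⊎∀ : {R U : Fin n → Set} → Decidable R → (∀ j → R j → A ⊎ U j) → A ⊎ (∀ j → R j → U j)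
∀⊎⇒⊎∀ {n = ℕ.zero} R? h = inj₂ λ ()
∀⊎⇒⊎∀ {n = ℕ.suc n} R? h with R? zero | ∀⊎⇒⊎∀ (R? ∘ suc) (h ∘ suc)
... | _     | inj₁ a = inj₁ a
... | no ¬r | inj₂ h′ = inj₂ λ { zero r → ⊥-elim (¬r r) ; (suc j) → h′ j }
... | yes r | inj₂ h′ with h zero r
...   | inj₁ a = inj₁ a
...   | inj₂ p = inj₂ λ { zero _ → p ; (suc j) → h′ j }

data Order : Set where
  lt eq gt : Order

private
  variable
    r : Order
    i j : Fin n

converse : Order → Order
converse lt = gt
converse eq = eq
converse gt = lt

_⟨_⟩_ : Fin n → Order → Fin n → Set
i ⟨ lt ⟩ j = i < j
i ⟨ eq ⟩ j = i ≡ j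
i ⟨ gt ⟩ j = j < i

_⟨_⟩?_ : (i : Fin n) (r : Order) (j : Fin n) → Dec (i ⟨ r ⟩ j)
i ⟨ lt ⟩? j = i <? j
i ⟨ eq ⟩? j = i ≟ j
i ⟨ gt ⟩? j = j <? i

⟨⟩-converse : i ⟨ r ⟩ j → j ⟨ converse r ⟩ i
⟨⟩-converse {r = lt} p = p
⟨⟩-converse {r = eq} p = sym p
⟨⟩-converse {r = gt} p = p

order : Fin n → Fin n → Order
order i j with <-cmp i j
... | tri< _ _ _ = lt
... | tri≈ _ _ _ = eq
... | tri> _ _ _ = gt

order-sound : (i j : Fin n) → i ⟨ order i j ⟩ j
order-sound i j with <-cmp i j
... | tri< i<j _ _ = i<j
... | tri≈ _ i≡j _ = i≡j
... | tri> _ _ j<i = j<i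

order-unique : i ⟨ r ⟩ j → order i j ≡ r
order-unique {i = i} {j = j} p with <-cmp i j
order-unique {r = lt} p | tri< _ _ _ = refl
order-unique {r = lt} p | tri≈ ¬p _ _ = ⊥-elim (¬p p)
order-unique {r = lt} p | tri> ¬p _ _ = ⊥-elim (¬p p)
order-unique {r = eq} p | tri< _ ¬p _ = ⊥-elim (¬p p)
order-unique {r = eq} p | tri≈ _ _ _ = refl
order-unique {r = eq} p | tri> _ ¬p _ = ⊥-elim (¬p p)
order-unique {r = gt} p | tri< _ _ ¬p = ⊥-elim (¬p p)
order-unique {r = gt} p | tri≈ _ _ ¬p = ⊥-elim (¬p p)
order-unique {r = gt} p | tri> _ _ _ = refl

order-refl : order i i ≡ eq
order-refl = order-unique refl

order-converse : {i j : Fin n} → order j i ≡ converse (order i j)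
order-converse {i = i} {j = j} = order-unique (⟨⟩-converse (order-sound i j))

∃-order : {U : Order → Fin n → Set} →
  (Σ[ j ∈ Fin n ] U (order i j) j) ⇔ (Σ[ r ∈ Order ] Σ[ j ∈ Fin n ] (i ⟨ r ⟩ j × U r j))
∃-order {i = i} {U = U} = mk⇔
  (λ (j , p) → order i j , j , order-sound i j , p)
  (λ (r , j , ij , p) → j , subst (λ s → U s j) (sym (order-unique ij)) p)

∀-order : {U : Order → Fin n → Set} →
  (∀ j → U (order i j) j) ⇔ (∀ r j → i ⟨ r ⟩ j → U r j)
∀-order {i = i} {U = U} = mk⇔
  (λ h r j ij → subst (λ s → U s j) (order-unique ij) (h j))
  (λ h j → h (order i j) j (order-sound i j))

≤⊎⇔<→ : {i j : Fin n} → (i ≤ j ⊎ A) ⇔ (j < i → A)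
≤⊎⇔<→ {i = i} {j} = mk⇔ [ (λ i≤j j<i → ⊥-elim (<⇒≱ j<i i≤j)) , const ] decide
  where
  decide : (j < i → A) → i ≤ j ⊎ A
  decide h with i ≤? j
  ... | yes i≤j = inj₁ i≤j
  ... | no i≰j = inj₂ (h (≰⇒> i≰j))

data Comparison : Set where
  <ᶜ ≤ᶜ =ᶜ ≠ᶜ : Comparison

Compare : Comparison → Fin n → Fin n → Set
Compare <ᶜ i j = i < j
Compare ≤ᶜ i j = i ≤ j
Compare =ᶜ i j = i ≡ j
Compare ≠ᶜ i j = i ≢ j

accepts : Comparison → Order → Bool
accepts <ᶜ lt = true
accepts <ᶜ _  = false
accepts ≤ᶜ gt = false
accepts ≤ᶜ _  = true
accepts =ᶜ eq = true
accepts =ᶜ _  = false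
accepts ≠ᶜ eq = false
accepts ≠ᶜ _  = true

Compare⇔accepts : (c : Comparison) (i j : Fin n) → Compare c i j ⇔ T (accepts c (order i j))
Compare⇔accepts c i j with <-cmp i j
Compare⇔accepts <ᶜ i j | tri< i<j _ _ = mk⇔ (const tt) (const i<j)
Compare⇔accepts <ᶜ i j | tri≈ i≮j _ _ = mk⇔ i≮j λ ()
Compare⇔accepts <ᶜ i j | tri> i≮j _ _ = mk⇔ i≮j λ ()
Compare⇔accepts ≤ᶜ i j | tri< i<j _ _ = mk⇔ (const tt) (const (<⇒≤ i<j))
Compare⇔accepts ≤ᶜ i j | tri≈ _ i≡j _ = mk⇔ (const tt) (const (≤-reflexive i≡j))
Compare⇔accepts ≤ᶜ i j | tri> _ _ j<i = mk⇔ (<⇒≱ j<i) λ ()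
Compare⇔accepts =ᶜ i j | tri< _ i≢j _ = mk⇔ i≢j λ ()
Compare⇔accepts =ᶜ i j | tri≈ _ i≡j _ = mk⇔ (const tt) (const i≡j)
Compare⇔accepts =ᶜ i j | tri> _ i≢j _ = mk⇔ i≢j λ ()
Compare⇔accepts ≠ᶜ i j | tri< _ i≢j _ = mk⇔ (const tt) (const i≢j)
Compare⇔accepts ≠ᶜ i j | tri≈ _ i≡j _ = mk⇔ (λ i≢j → i≢j i≡j) λ ()
Compare⇔accepts ≠ᶜ i j | tri> _ i≢j _ = mk⇔ (const tt) (const i≢j)

orientation : Var → Var → Order → Order
orientation vx vx _ = eq
orientation vx vy r = r
orientation vy vx r = converse r
orientation vy vy _ = eq

order-orientation : (a b : Var) (σ : Var → Fin n) →
  order (σ a) (σ b) ≡ orientation a b (order (σ vx) (σ vy))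
order-orientation vx vx σ = order-refl
order-orientation vx vy σ = refl
order-orientation vy vx σ = order-converse
order-orientation vy vy σ = order-refl

-- Separated formulas and quantifier elimination

◇ □ : Order → UTL k → UTL k
◇ lt β = F β
◇ eq β = β
◇ gt β = P β
□ lt β = G β
□ eq β = β
□ gt β = H β

⋁ᵒ ⋀ᵒ : (Order → UTL k) → UTL k
⋁ᵒ f = f lt ∨′ (f eq ∨′ f gt)
⋀ᵒ f = f lt ∧′ (f eq ∧′ f gt)

⌜_⌝ : Bool → UTL k
⌜ b ⌝ = if b then tt else ff

data Sep (k : ℕ) : Set where
  X Y : UTL k → Sep k
  _∧ˢ_ _∨ˢ_ : Sep k → Sep k → Sep k

-- A formula φ(x, y) is separated by giving, for each order type r of (x, y), a positive
-- Boolean combination of UTL formulas at x (X) and at y (Y) equivalent to φ when x ⟨ r ⟩ y.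
Separated : ℕ → Set
Separated k = Order → Sep k

swapˢ : Sep k → Sep k
swapˢ (X a) = Y a
swapˢ (Y b) = X b
swapˢ (n ∧ˢ n′) = swapˢ n ∧ˢ swapˢ n′
swapˢ (n ∨ˢ n′) = swapˢ n ∨ˢ swapˢ n′

swap : Separated k → Separated k
swap t r = swapˢ (t (converse r))

diagonal : Sep k → UTL k
diagonal (X a) = a
diagonal (Y b) = b
diagonal (n ∧ˢ n′) = diagonal n ∧′ diagonal n′
diagonal (n ∨ˢ n′) = diagonal n ∨′ diagonal n′

data DNF (k : ℕ) : Set where
  conj : UTL k → UTL k → DNF k
  _∨ᵈ_ : DNF k → DNF k → DNF k

data CNF (k : ℕ) : Set where
  disj : UTL k → UTL k → CNF k
  _∧ᶜ_ : CNF k → CNF k → CNF k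

_∧ᵈ_ : DNF k → DNF k → DNF k
conj a b ∧ᵈ conj a′ b′ = conj (a ∧′ a′) (b ∧′ b′)
conj a b ∧ᵈ (e ∨ᵈ e′) = (conj a b ∧ᵈ e) ∨ᵈ (conj a b ∧ᵈ e′)
(d ∨ᵈ d′) ∧ᵈ e = (d ∧ᵈ e) ∨ᵈ (d′ ∧ᵈ e)

_∨ᶜ_ : CNF k → CNF k → CNF k
disj a b ∨ᶜ disj a′ b′ = disj (a ∨′ a′) (b ∨′ b′)
disj a b ∨ᶜ (e ∧ᶜ e′) = (disj a b ∨ᶜ e) ∧ᶜ (disj a b ∨ᶜ e′)
(c ∧ᶜ c′) ∨ᶜ e = (c ∨ᶜ e) ∧ᶜ (c′ ∨ᶜ e)

dnf : Sep k → DNF k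
dnf (X a) = conj a tt
dnf (Y b) = conj tt b
dnf (n ∧ˢ n′) = dnf n ∧ᵈ dnf n′
dnf (n ∨ˢ n′) = dnf n ∨ᵈ dnf n′

cnf : Sep k → CNF k
cnf (X a) = disj a ff
cnf (Y b) = disj ff b
cnf (n ∧ˢ n′) = cnf n ∧ᶜ cnf n′
cnf (n ∨ˢ n′) = cnf n ∨ᶜ cnf n′

∃ᵈ : Order → DNF k → UTL k
∃ᵈ r (conj a b) = a ∧′ ◇ r b
∃ᵈ r (d ∨ᵈ d′) = ∃ᵈ r d ∨′ ∃ᵈ r d′

∀ᶜ : Order → CNF k → UTL k
∀ᶜ r (disj a b) = a ∨′ □ r b
∀ᶜ r (c ∧ᶜ c′) = ∀ᶜ r c ∧′ ∀ᶜ r c′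

∃ʸ ∀ʸ : Separated k → UTL k
∃ʸ t = ⋁ᵒ λ r → ∃ᵈ r (dnf (t r))
∀ʸ t = ⋀ᵒ λ r → ∀ᶜ r (cnf (t r))

comparison : Comparison → Var → Var → Separated k
comparison c a b r = X ⌜ accepts c (orientation a b r) ⌝

separate : FO2 k → Separated k
separate ff _ = X ff
separate tt _ = X tt
separate (a <′ b) = comparison <ᶜ a b
separate (a ≤′ b) = comparison ≤ᶜ a b
separate (a =′ b) = comparison =ᶜ a b
separate (a ≠′ b) = comparison ≠ᶜ a b
separate (atom c vx) _ = X (atom c)
separate (atom c vy) _ = Y (atom c)
separate (φ ∧′ ψ) r = separate φ r ∧ˢ separate ψ r
separate (φ ∨′ ψ) r = separate φ r ∨ˢ separate ψ r
separate (∃′ vy φ) _ = X (∃ʸ (separate φ))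
separate (∃′ vx φ) _ = Y (∃ʸ (swap (separate φ)))
separate (∀′ vy φ) _ = X (∀ʸ (separate φ))
separate (∀′ vx φ) _ = Y (∀ʸ (swap (separate φ)))

module _ {k : ℕ} (u : Word k) where

  _⊨_ : Pos u → UTL k → Set
  i ⊨ φ = u , i ⊨UTL φ

  ⟦_⟧ˢ : Sep k → Pos u → Pos u → Set
  ⟦ X a ⟧ˢ i j = i ⊨ a
  ⟦ Y b ⟧ˢ i j = j ⊨ b
  ⟦ n ∧ˢ n′ ⟧ˢ i j = ⟦ n ⟧ˢ i j × ⟦ n′ ⟧ˢ i j
  ⟦ n ∨ˢ n′ ⟧ˢ i j = ⟦ n ⟧ˢ i j ⊎ ⟦ n′ ⟧ˢ i j

  ⟦_⟧ : Separated k → Pos u → Pos u → Set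
  ⟦ t ⟧ i j = ⟦ t (order i j) ⟧ˢ i j

  ⟦_⟧ᵈ : DNF k → Pos u → Pos u → Set
  ⟦ conj a b ⟧ᵈ i j = i ⊨ a × j ⊨ b
  ⟦ d ∨ᵈ d′ ⟧ᵈ i j = ⟦ d ⟧ᵈ i j ⊎ ⟦ d′ ⟧ᵈ i j

  ⟦_⟧ᶜ : CNF k → Pos u → Pos u → Set
  ⟦ disj a b ⟧ᶜ i j = i ⊨ a ⊎ j ⊨ b
  ⟦ c ∧ᶜ c′ ⟧ᶜ i j = ⟦ c ⟧ᶜ i j × ⟦ c′ ⟧ᶜ i j

  ◇-sem : (r : Order) (β : UTL k) → (Σ[ j ∈ Pos u ] (i ⟨ r ⟩ j × j ⊨ β)) ⇔ i ⊨ ◇ r β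
  ◇-sem lt β = ⇔-id _
  ◇-sem eq β = mk⇔ (λ { (_ , refl , p) → p }) (λ p → _ , refl , p)
  ◇-sem gt β = ⇔-id _

  □-sem : (r : Order) (β : UTL k) → (∀ j → i ⟨ r ⟩ j → j ⊨ β) ⇔ i ⊨ □ r β
  □-sem lt β = ⇔-id _
  □-sem eq β = mk⇔ (λ h → h _ refl) (λ { p _ refl → p })
  □-sem gt β = ⇔-id _

  ⋁ᵒ-sem : (f : Order → UTL k) → i ⊨ ⋁ᵒ f ⇔ (Σ[ r ∈ Order ] i ⊨ f r)
  ⋁ᵒ-sem f = mk⇔ [ (lt ,_) , [ (eq ,_) , (gt ,_) ] ] λ where
    (lt , p) → inj₁ p
    (eq , p) → inj₂ (inj₁ p)
    (gt , p) → inj₂ (inj₂ p)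

  ⋀ᵒ-sem : (f : Order → UTL k) → i ⊨ ⋀ᵒ f ⇔ (∀ r → i ⊨ f r)
  ⋀ᵒ-sem f = mk⇔ (λ (p , q , s) → λ { lt → p ; eq → q ; gt → s }) (λ h → h lt , h eq , h gt)

  ⌜⌝-sem : (b : Bool) → T b ⇔ i ⊨ ⌜ b ⌝
  ⌜⌝-sem true = ⇔-id _
  ⌜⌝-sem false = ⇔-id _

  swapˢ-sem : (n : Sep k) → ⟦ swapˢ n ⟧ˢ i j ⇔ ⟦ n ⟧ˢ j i
  swapˢ-sem (X a) = ⇔-id _
  swapˢ-sem (Y b) = ⇔-id _
  swapˢ-sem (n ∧ˢ n′) = swapˢ-sem n ×-⇔ swapˢ-sem n′
  swapˢ-sem (n ∨ˢ n′) = swapˢ-sem n ⊎-⇔ swapˢ-sem n′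

  swap-sem : (t : Separated k) (i j : Pos u) → ⟦ swap t ⟧ i j ⇔ ⟦ t ⟧ j i
  swap-sem t i j rewrite order-converse {i = i} {j} = swapˢ-sem (t (converse (order i j)))

  diagonal-sem : (n : Sep k) → ⟦ n ⟧ˢ i i ⇔ i ⊨ diagonal n
  diagonal-sem (X a) = ⇔-id _
  diagonal-sem (Y b) = ⇔-id _
  diagonal-sem (n ∧ˢ n′) = diagonal-sem n ×-⇔ diagonal-sem n′
  diagonal-sem (n ∨ˢ n′) = diagonal-sem n ⊎-⇔ diagonal-sem n′

  ∧ᵈ-sem : (d e : DNF k) → ⟦ d ∧ᵈ e ⟧ᵈ i j ⇔ (⟦ d ⟧ᵈ i j × ⟦ e ⟧ᵈ i j)
  ∧ᵈ-sem (conj a b) (conj a′ b′) = ×-interchange _ _ _ _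
  ∧ᵈ-sem (conj a b) (e ∨ᵈ e′) =
    ⇔-sym (↔⇒⇔ ×-distribˡ-⊎) ⇔-∘ (∧ᵈ-sem (conj a b) e ⊎-⇔ ∧ᵈ-sem (conj a b) e′)
  ∧ᵈ-sem (d ∨ᵈ d′) e = ⇔-sym (↔⇒⇔ ×-distribʳ-⊎) ⇔-∘ (∧ᵈ-sem d e ⊎-⇔ ∧ᵈ-sem d′ e)

  ∨ᶜ-sem : (c e : CNF k) → ⟦ c ∨ᶜ e ⟧ᶜ i j ⇔ (⟦ c ⟧ᶜ i j ⊎ ⟦ e ⟧ᶜ i j)
  ∨ᶜ-sem (disj a b) (disj a′ b′) = ⊎-interchange _ _ _ _
  ∨ᶜ-sem (disj a b) (e ∧ᶜ e′) =
    ⇔-sym ⊎-distribˡ-× ⇔-∘ (∨ᶜ-sem (disj a b) e ×-⇔ ∨ᶜ-sem (disj a b) e′)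
  ∨ᶜ-sem (c ∧ᶜ c′) e = ⇔-sym ⊎-distribʳ-× ⇔-∘ (∨ᶜ-sem c e ×-⇔ ∨ᶜ-sem c′ e)

  dnf-sem : (n : Sep k) → ⟦ n ⟧ˢ i j ⇔ ⟦ dnf n ⟧ᵈ i j
  dnf-sem (X a) = mk⇔ (_, tt) proj₁
  dnf-sem (Y b) = mk⇔ (tt ,_) proj₂
  dnf-sem (n ∧ˢ n′) = ⇔-sym (∧ᵈ-sem (dnf n) (dnf n′)) ⇔-∘ (dnf-sem n ×-⇔ dnf-sem n′)
  dnf-sem (n ∨ˢ n′) = dnf-sem n ⊎-⇔ dnf-sem n′

  cnf-sem : (n : Sep k) → ⟦ n ⟧ˢ i j ⇔ ⟦ cnf n ⟧ᶜ i j
  cnf-sem (X a) = mk⇔ inj₁ [ (λ a → a) , (λ ()) ]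
  cnf-sem (Y b) = mk⇔ inj₂ [ (λ ()) , (λ b → b) ]
  cnf-sem (n ∧ˢ n′) = cnf-sem n ×-⇔ cnf-sem n′
  cnf-sem (n ∨ˢ n′) = ⇔-sym (∨ᶜ-sem (cnf n) (cnf n′)) ⇔-∘ (cnf-sem n ⊎-⇔ cnf-sem n′)

  ∃ᵈ-sem : (d : DNF k) → (Σ[ j ∈ Pos u ] (i ⟨ r ⟩ j × ⟦ d ⟧ᵈ i j)) ⇔ i ⊨ ∃ᵈ r d
  ∃ᵈ-sem {r = r} (conj a b) = mk⇔
    (λ (j , ij , p , q) → p , to (◇-sem r b) (j , ij , q))
    (λ (p , q) → let (j , ij , q′) = from (◇-sem r b) q in j , ij , p , q′)
  ∃ᵈ-sem (d ∨ᵈ d′) = (∃ᵈ-sem d ⊎-⇔ ∃ᵈ-sem d′) ⇔-∘ guarded-∃-distrib-⊎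

  ∀ᶜ-sem : (c : CNF k) → (∀ j → i ⟨ r ⟩ j → ⟦ c ⟧ᶜ i j) ⇔ i ⊨ ∀ᶜ r c
  ∀ᶜ-sem {i = i} {r = r} (disj a b) = mk⇔
    (λ h → map₂ (to (□-sem r b)) (∀⊎⇒⊎∀ (i ⟨ r ⟩?_) h))
    [ (λ p _ _ → inj₁ p) , (λ q j ij → inj₂ (from (□-sem r b) q j ij)) ]
  ∀ᶜ-sem (c ∧ᶜ c′) = (∀ᶜ-sem c ×-⇔ ∀ᶜ-sem c′) ⇔-∘ guarded-∀-distrib-×

  ∃ʸ-sem : (t : Separated k) (i : Pos u) → (Σ[ j ∈ Pos u ] ⟦ t ⟧ i j) ⇔ i ⊨ ∃ʸ t
  ∃ʸ-sem t i = begin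
    (Σ[ j ∈ Pos u ] ⟦ t (order i j) ⟧ˢ i j)
      ∼⟨ ∃-order {U = λ r j → ⟦ t r ⟧ˢ i j} ⟩
    (Σ[ r ∈ Order ] Σ[ j ∈ Pos u ] (i ⟨ r ⟩ j × ⟦ t r ⟧ˢ i j))
      ∼⟨ Σ-cong (λ r → Σ-cong λ _ → ⇔-id _ ×-⇔ dnf-sem (t r)) ⟩
    (Σ[ r ∈ Order ] Σ[ j ∈ Pos u ] (i ⟨ r ⟩ j × ⟦ dnf (t r) ⟧ᵈ i j))
      ∼⟨ Σ-cong (λ r → ∃ᵈ-sem (dnf (t r))) ⟩
    (Σ[ r ∈ Order ] i ⊨ ∃ᵈ r (dnf (t r)))
      ∼⟨ ⇔-sym (⋁ᵒ-sem λ r → ∃ᵈ r (dnf (t r))) ⟩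
    i ⊨ ∃ʸ t ∎

  ∀ʸ-sem : (t : Separated k) (i : Pos u) → (∀ j → ⟦ t ⟧ i j) ⇔ i ⊨ ∀ʸ t
  ∀ʸ-sem t i = begin
    (∀ j → ⟦ t (order i j) ⟧ˢ i j)
      ∼⟨ ∀-order {U = λ r j → ⟦ t r ⟧ˢ i j} ⟩
    (∀ r j → i ⟨ r ⟩ j → ⟦ t r ⟧ˢ i j)
      ∼⟨ Π-cong (λ r → Π-cong λ _ → →-cong-⇔ (⇔-id _) (cnf-sem (t r))) ⟩
    (∀ r j → i ⟨ r ⟩ j → ⟦ cnf (t r) ⟧ᶜ i j)
      ∼⟨ Π-cong (λ r → ∀ᶜ-sem (cnf (t r))) ⟩
    (∀ r → i ⊨ ∀ᶜ r (cnf (t r)))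
      ∼⟨ ⇔-sym (⋀ᵒ-sem λ r → ∀ᶜ r (cnf (t r))) ⟩
    i ⊨ ∀ʸ t ∎

  comparison-sem : (c : Comparison) (a b : Var) (σ : Env u) →
    Compare c (σ a) (σ b) ⇔ ⟦ comparison c a b ⟧ (σ vx) (σ vy)
  comparison-sem c a b σ = begin
    Compare c (σ a) (σ b)
      ∼⟨ Compare⇔accepts c (σ a) (σ b) ⟩
    T (accepts c (order (σ a) (σ b)))
      ≡⟨ cong (T ∘ accepts c) (order-orientation a b σ) ⟩
    T (accepts c (orientation a b (order (σ vx) (σ vy))))
      ∼⟨ ⌜⌝-sem _ ⟩
    σ vx ⊨ ⌜ accepts c (orientation a b (order (σ vx) (σ vy))) ⌝ ∎

  separate-sem : (φ : FO2 k) (σ : Env u) → (u , σ ⊨FO φ) ⇔ ⟦ separate φ ⟧ (σ vx) (σ vy)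
  separate-sem ff σ = ⇔-id _
  separate-sem tt σ = ⇔-id _
  separate-sem (a <′ b) σ = comparison-sem <ᶜ a b σ
  separate-sem (a ≤′ b) σ = comparison-sem ≤ᶜ a b σ
  separate-sem (a =′ b) σ = comparison-sem =ᶜ a b σ
  separate-sem (a ≠′ b) σ = comparison-sem ≠ᶜ a b σ
  separate-sem (atom c vx) σ = ⇔-id _
  separate-sem (atom c vy) σ = ⇔-id _
  separate-sem (φ ∧′ ψ) σ = separate-sem φ σ ×-⇔ separate-sem ψ σ
  separate-sem (φ ∨′ ψ) σ = separate-sem φ σ ⊎-⇔ separate-sem ψ σ
  separate-sem (∃′ vy φ) σ = ∃ʸ-sem (separate φ) (σ vx) ⇔-∘ Σ-cong (λ _ → separate-sem φ _)
  separate-sem (∃′ vx φ) σ = ∃ʸ-sem (swap (separate φ)) (σ vy) ⇔-∘ Σ-cong λ i →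
    ⇔-sym (swap-sem (separate φ) (σ vy) i) ⇔-∘ separate-sem φ _
  separate-sem (∀′ vy φ) σ = ∀ʸ-sem (separate φ) (σ vx) ⇔-∘ Π-cong (λ _ → separate-sem φ _)
  separate-sem (∀′ vx φ) σ = ∀ʸ-sem (swap (separate φ)) (σ vy) ⇔-∘ Π-cong λ i →
    ⇔-sym (swap-sem (separate φ) (σ vy) i) ⇔-∘ separate-sem φ _

  separate-diagonal-sem : (φ : FO2 k) (i : Pos u) →
    (u , [x↦_] {u = u} i ⊨FO φ) ⇔ i ⊨ diagonal (separate φ eq)
  separate-diagonal-sem φ i = begin
    (u , [x↦_] {u = u} i ⊨FO φ)      ∼⟨ separate-sem φ ([x↦_] {u = u} i) ⟩
    ⟦ separate φ (order i i) ⟧ˢ i i  ≡⟨ cong (λ r → ⟦ separate φ r ⟧ˢ i i) order-refl ⟩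
    ⟦ separate φ eq ⟧ˢ i i           ∼⟨ diagonal-sem (separate φ eq) ⟩
    i ⊨ diagonal (separate φ eq) ∎

-- The standard translation

other : Var → Var
other vx = vy
other vy = vx

≢other⇒≡ : {v w : Var} → w ≢ other v → w ≡ v
≢other⇒≡ {vx} {vx} _ = refl
≢other⇒≡ {vx} {vy} w≢ = ⊥-elim (w≢ refl)
≢other⇒≡ {vy} {vx} w≢ = ⊥-elim (w≢ refl)
≢other⇒≡ {vy} {vy} _ = refl

standard : Var → UTL k → FO2 k
standard v ff = ff
standard v tt = tt
standard v (atom a) = atom a v
standard v (φ ∧′ ψ) = standard v φ ∧′ standard v ψ
standard v (φ ∨′ ψ) = standard v φ ∨′ standard v ψ
standard v (P ψ) = ∃′ (other v) ((other v <′ v) ∧′ standard (other v) ψ)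
standard v (F ψ) = ∃′ (other v) ((v <′ other v) ∧′ standard (other v) ψ)
standard v (H ψ) = ∀′ (other v) ((v ≤′ other v) ∨′ standard (other v) ψ)
standard v (G ψ) = ∀′ (other v) ((other v ≤′ v) ∨′ standard (other v) ψ)

standard-free : (v : Var) (ψ : UTL k) {w : Var} → FreeIn w (standard v ψ) → w ≡ v
standard-free v ff ()
standard-free v tt ()
standard-free v (atom a) w≡v = w≡v
standard-free v (φ ∧′ ψ) = [ standard-free v φ , standard-free v ψ ]
standard-free v (φ ∨′ ψ) = [ standard-free v φ , standard-free v ψ ]
standard-free v (P ψ) (w≢ , _) = ≢other⇒≡ w≢
standard-free v (F ψ) (w≢ , _) = ≢other⇒≡ w≢
standard-free v (H ψ) (w≢ , _) = ≢other⇒≡ w≢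
standard-free v (G ψ) (w≢ , _) = ≢other⇒≡ w≢

standard-oneFreeX : (ψ : UTL k) → OneFreeX (standard vx ψ)
standard-oneFreeX ψ y-free with standard-free vx ψ y-free
... | ()

standard-sem : {u : Word k} (v : Var) (ψ : UTL k) (σ : Env u) →
  (u , σ ⊨FO standard v ψ) ⇔ (u , σ v ⊨UTL ψ)
standard-sem v ff σ = ⇔-id _
standard-sem v tt σ = ⇔-id _
standard-sem v (atom a) σ = ⇔-id _
standard-sem v (φ ∧′ ψ) σ = standard-sem v φ σ ×-⇔ standard-sem v ψ σ
standard-sem v (φ ∨′ ψ) σ = standard-sem v φ σ ⊎-⇔ standard-sem v ψ σ
standard-sem vx (P ψ) _ = Σ-cong λ _ → ⇔-id _ ×-⇔ standard-sem vy ψ _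
standard-sem vy (P ψ) _ = Σ-cong λ _ → ⇔-id _ ×-⇔ standard-sem vx ψ _
standard-sem vx (F ψ) _ = Σ-cong λ _ → ⇔-id _ ×-⇔ standard-sem vy ψ _
standard-sem vy (F ψ) _ = Σ-cong λ _ → ⇔-id _ ×-⇔ standard-sem vx ψ _
standard-sem vx (H ψ) _ = Π-cong λ _ → ≤⊎⇔<→ ⇔-∘ (⇔-id _ ⊎-⇔ standard-sem vy ψ _)
standard-sem vy (H ψ) _ = Π-cong λ _ → ≤⊎⇔<→ ⇔-∘ (⇔-id _ ⊎-⇔ standard-sem vx ψ _)
standard-sem vx (G ψ) _ = Π-cong λ _ → ≤⊎⇔<→ ⇔-∘ (⇔-id _ ⊎-⇔ standard-sem vy ψ _)
standard-sem vy (G ψ) _ = Π-cong λ _ → ≤⊎⇔<→ ⇔-∘ (⇔-id _ ⊎-⇔ standard-sem vx ψ _)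

-- No hypothesis on free variables is needed: [x↦ i ] also sends y to i.
FO2⇒UTL : (φ : FO2 k) → Σ[ ψ ∈ UTL k ]
  ((u : Word k) (i : Pos u) → (u , [x↦_] {u = u} i ⊨FO φ) ⇔ (u , i ⊨UTL ψ))
FO2⇒UTL φ = diagonal (separate φ eq) , λ u i → separate-diagonal-sem u φ i

UTL⇒FO2 : (ψ : UTL k) → Σ[ φ ∈ FO2 k ] (OneFreeX φ ×
  ((u : Word k) (i : Pos u) → (u , [x↦_] {u = u} i ⊨FO φ) ⇔ (u , i ⊨UTL ψ)))
UTL⇒FO2 ψ = standard vx ψ , standard-oneFreeX ψ , λ u i → standard-sem vx ψ ([x↦_] {u = u} i)

corollary28 : (k : ℕ)
  → ((φ : FO2 k) → OneFreeX φ → Σ[ ψ ∈ UTL k ]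
       ((u : Word k) (i : Pos u) → (u , [x↦_] {u = u} i ⊨FO φ) ⇔ (u , i ⊨UTL ψ)))
  × ((ψ : UTL k) → Σ[ φ ∈ FO2 k ] (OneFreeX φ ×
       ((u : Word k) (i : Pos u) → (u , [x↦_] {u = u} i ⊨FO φ) ⇔ (u , i ⊨UTL ψ))))
corollary28 k = (λ φ _ → FO2⇒UTL φ) , UTL⇒FO2
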